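{- Let $k>1$ be an integer, $\sigma$ a permutation of $\{0,1,\ldots,n\}$, and let $r=[a_0;a_1,\ldots,a_n]$ be a $(\sigma,k)$-permutiple. Let $p_n=K_{n+1}(a_0,\ldots,a_n)$ and $p'_n=K_{n+1}(a_{\sigma(0)},\ldots,a_{\sigma(n)})$. If $\frac{p_n}{p'_n}<2$, then $r$ is continuant-preserving, i.e. $p_n=p'_n$.
   Context: For positive integers $a_0,\ldots,a_n$, $[a_0;a_1,\ldots,a_n]$ denotes the finite simple continued fraction $a_0+1/(a_1+1/(\cdots+1/a_n))$; all finite continued fractions are assumed in canonical form (last digit at least $2$ when there are at least two digits). For an integer $k>1$ and a permutation $\sigma$ of $\{0,\ldots,n\}$, $r=[a_0;\ldots,a_n]$ is a $(\sigma,k)$-permutiple if $r=k\,[a_{\sigma(0)};a_{\sigma(1)},\ldots,a_{\sigma(n)}]$. Continuants: $K_0()=1$, $K_1(x_0)=x_0$, $K_m(x_0,\ldots,x_{m-1})=x_{m-1}K_{m-1}(x_0,\ldots,x_{m-2})+K_{m-2}(x_0,\ldots,x_{m-3})$. The permutiple is continuant-preserving if $K_{n+1}(a_0,\ldots,a_n)=K_{n+1}(a_{\sigma(0)},\ldots,a_{\sigma(n)})$. -}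

module Defs where

open import Data.Nat using (ℕ; zero; suc; _+_; _*_; _≤_; _<_)
open import Data.Fin using (Fin; toℕ)
open import Data.List using (List; []; _∷_)
open import Data.Product using (_×_; _,_; proj₁; proj₂)
open import Data.Vec.Functional using (Vector; toList)
open import Relation.Binary.PropositionalEquality using (_≡_)

-- Continuants K_m(x_0,...,x_{m-1}), defined exactly as in the paper via
-- K_0() = 1, K_1(x_0) = x_0,
-- K_m(x_0..x_{m-1}) = x_{m-1} K_{m-1}(x_0..x_{m-2}) + K_{m-2}(x_0..x_{m-3}).
-- We compute the pair (K_m(xs), K_{m-1}(init xs)) on a vector, last index first.
-- For m = 0 the second component is a dummy 0.
Kpair : (m : ℕ) → Vector ℕ m → ℕ × ℕ
Kpair zero x = 1 , 0
Kpair (suc zero) x = x Data.Fin.zero , 1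
Kpair (suc (suc m)) x =
  let (k1 , k2) = Kpair (suc m) (λ i → x (Data.Fin.inject₁ i))
  in x (Data.Fin.fromℕ (suc m)) * k1 + k2 , k1

K : (m : ℕ) → Vector ℕ m → ℕ
K m x = proj₁ (Kpair m x)

-- The finite simple continued fraction [a_0; a_1, ..., a_n] as a fraction
-- (numerator , denominator), computed by the recursion
-- [a] = a/1 and [a_0; rest] = a_0 + 1/[rest].
cfFrac : List ℕ → ℕ × ℕ
cfFrac [] = 0 , 1   -- unused (sequences are nonempty)
cfFrac (a ∷ []) = a , 1
cfFrac (a ∷ b ∷ rest) =
  let (p , q) = cfFrac (b ∷ rest) in a * p + q , p

Positive : (n : ℕ) → Vector ℕ (suc n) → Set
Positive n a = (i : Fin (suc n)) → 1 ≤ a i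

Canonical : (n : ℕ) → Vector ℕ (suc n) → Set
Canonical zero a = Data.Unit.⊤ where import Data.Unit
Canonical (suc n) a = 2 ≤ a (Data.Fin.fromℕ (suc n))

cf : (n : ℕ) → Vector ℕ (suc n) → ℕ × ℕ
cf n a = cfFrac (toList a)

-- The rational identity  P/Q = k * (P'/Q')  for fractions with positive
-- denominators, written with cleared denominators: P * Q' = k * P' * Q.
EqTimes : ℕ × ℕ → ℕ → ℕ × ℕ → Set
EqTimes (P , Q) k (P' , Q') = P * Q' ≡ k * P' * Q

module Submission where

--  (1) The numerator of [a_0; a_1, ..., a_n] in lowest terms is the continuant
--      K_{n+1}(a_0, ..., a_n).  With D(x) = [[x,1],[1,0]], the first column of
--      D(a_0)⋯D(a_n) is (numerator, denominator) of the continued fraction,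
--      while the first column of D(a_n)⋯D(a_0) is (K_{n+1}, K_n) by the
--      defining recursion of K.  The two products are transposes of each
--      other (each D(x) is symmetric), so their top-left entries agree.
--  (2) Numerator and denominator of the continued fraction are coprime and
--      the numerator is positive.
--
-- Writing r = P/Q and r' = P'/Q', the permutiple equation reads
-- P Q' = k P' Q.  Since gcd(P', Q') = 1 this forces P' ∣ P, and a positive
-- multiple of P' below 2 P' is P' itself; by (1), P = p_n and P' = p'_n.

open import Defs
open import Data.Nat using (ℕ; suc; zero; _*_; _+_; _<_; _≤_; z≤n; s≤s)
open import Data.Nat.Properties using (≤-trans; ≤-reflexive; *-identityˡ; *-monoˡ-≤; *-comm; m≤m+n; +-identityʳ; <-irrefl; <-≤-trans)
open import Data.Nat.Divisibility using (_∣_; divides; ∣n⇒∣m*n; ∣m+n∣m⇒∣n; ∣1⇒≡1)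
open import Data.Nat.Coprimality using (Coprime; coprime-divisor)
open import Data.Nat.Tactic.RingSolver using (solve-∀)
open import Data.Fin using (Fin; fromℕ; inject₁)
open import Data.Fin.Permutation using (Permutation′; _⟨$⟩ʳ_)
open import Data.Product using (_×_; _,_; proj₁; proj₂)
open import Data.Vec.Functional using (Vector; head; tail)
open import Data.Empty using (⊥-elim)
open import Function using (_∘_)
open import Relation.Binary.PropositionalEquality
open ≡-Reasoning

-- 2×2 matrices over ℕ, entries listed row by row.
record Mat : Set where
  constructor mat
  field
    e₁₁ e₁₂ e₂₁ e₂₂ : ℕ
open Mat

mat-≡ : ∀ {a b c d a′ b′ c′ d′} → a ≡ a′ → b ≡ b′ → c ≡ c′ → d ≡ d′ →
        mat a b c d ≡ mat a′ b′ c′ d′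
mat-≡ refl refl refl refl = refl

infixl 7 _⊗_
_⊗_ : Mat → Mat → Mat
mat a b c d ⊗ mat e f g h = mat (a * e + b * g) (a * f + b * h) (c * e + d * g) (c * f + d * h)

𝟙 : Mat
𝟙 = mat 1 0 0 1

_ᵀ : Mat → Mat
mat a b c d ᵀ = mat a c b d

col₁ : Mat → ℕ × ℕ
col₁ A = e₁₁ A , e₂₁ A

digit : ℕ → Mat
digit x = mat x 1 1 0

⊗-assoc : ∀ A B C → A ⊗ B ⊗ C ≡ A ⊗ (B ⊗ C)
⊗-assoc (mat a b c d) (mat e f g h) (mat i j k l) =
  mat-≡ (entry a b e f g h i k) (entry a b e f g h j l)
        (entry c d e f g h i k) (entry c d e f g h j l)
  where
  entry : ∀ a b e f g h i k →
          (a * e + b * g) * i + (a * f + b * h) * k ≡ a * (e * i + f * k) + b * (g * i + h * k)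
  entry = solve-∀

⊗-identityˡ : ∀ A → 𝟙 ⊗ A ≡ A
⊗-identityˡ (mat a b c d) = mat-≡ (entry a c) (entry b d) (entry′ a c) (entry′ b d)
  where
  entry : ∀ a c → 1 * a + 0 * c ≡ a
  entry = solve-∀
  entry′ : ∀ a c → 0 * a + 1 * c ≡ c
  entry′ = solve-∀

⊗-identityʳ : ∀ A → A ⊗ 𝟙 ≡ A
⊗-identityʳ (mat a b c d) = mat-≡ (entry a b) (entry′ a b) (entry c d) (entry′ c d)
  where
  entry : ∀ a b → a * 1 + b * 0 ≡ a
  entry = solve-∀
  entry′ : ∀ a b → a * 0 + b * 1 ≡ b
  entry′ = solve-∀

ᵀ-⊗ : ∀ A B → (A ⊗ B) ᵀ ≡ B ᵀ ⊗ A ᵀ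
ᵀ-⊗ (mat a b c d) (mat e f g h) = mat-≡ (entry a b e g) (entry c d e g) (entry a b f h) (entry c d f h)
  where
  entry : ∀ a b e g → a * e + b * g ≡ e * a + g * b
  entry = solve-∀

col₁-digit : ∀ x A → col₁ (digit x ⊗ A) ≡ (x * e₁₁ A + e₂₁ A , e₁₁ A)
col₁-digit x A = cong₂ _,_ (entry x (e₁₁ A) (e₂₁ A)) (entry′ (e₁₁ A) (e₂₁ A))
  where
  entry : ∀ x p q → x * p + 1 * q ≡ x * p + q
  entry = solve-∀
  entry′ : ∀ p q → 1 * p + 0 * q ≡ p
  entry′ = solve-∀

forwardProd : (m : ℕ) → Vector ℕ m → Mat
forwardProd zero    x = 𝟙
forwardProd (suc m) x = digit (head x) ⊗ forwardProd m (tail x)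

backwardProd : (m : ℕ) → Vector ℕ m → Mat
backwardProd zero    x = 𝟙
backwardProd (suc m) x = digit (x (fromℕ m)) ⊗ backwardProd m (x ∘ inject₁)

forwardProd-snoc : ∀ m (x : Vector ℕ (suc m)) →
                   forwardProd (suc m) x ≡ forwardProd m (x ∘ inject₁) ⊗ digit (x (fromℕ m))
forwardProd-snoc zero x = trans (⊗-identityʳ (digit (head x))) (sym (⊗-identityˡ (digit (head x))))
forwardProd-snoc (suc m) x = begin
  digit (head x) ⊗ forwardProd (suc m) (tail x)
    ≡⟨ cong (digit (head x) ⊗_) (forwardProd-snoc m (tail x)) ⟩
  digit (head x) ⊗ (forwardProd m (tail x ∘ inject₁) ⊗ digit (x (fromℕ (suc m))))
    ≡⟨ sym (⊗-assoc (digit (head x)) _ _) ⟩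
  forwardProd (suc m) (x ∘ inject₁) ⊗ digit (x (fromℕ (suc m)))
    ∎

-- Since each digit matrix is symmetric, the two products are transposes.
backwardProd≡forwardProdᵀ : ∀ m (x : Vector ℕ m) → backwardProd m x ≡ forwardProd m x ᵀ
backwardProd≡forwardProdᵀ zero    x = refl
backwardProd≡forwardProdᵀ (suc m) x = begin
  digit (x (fromℕ m)) ⊗ backwardProd m (x ∘ inject₁)
    ≡⟨ cong (digit (x (fromℕ m)) ⊗_) (backwardProd≡forwardProdᵀ m (x ∘ inject₁)) ⟩
  digit (x (fromℕ m)) ᵀ ⊗ forwardProd m (x ∘ inject₁) ᵀ
    ≡⟨ sym (ᵀ-⊗ (forwardProd m (x ∘ inject₁)) (digit (x (fromℕ m)))) ⟩
  (forwardProd m (x ∘ inject₁) ⊗ digit (x (fromℕ m))) ᵀ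
    ≡⟨ cong _ᵀ (sym (forwardProd-snoc m x)) ⟩
  forwardProd (suc m) x ᵀ
    ∎

Kpair≡col₁-backwardProd : ∀ m (x : Vector ℕ (suc m)) → Kpair (suc m) x ≡ col₁ (backwardProd (suc m) x)
Kpair≡col₁-backwardProd zero    x = cong col₁ (sym (⊗-identityʳ (digit (head x))))
Kpair≡col₁-backwardProd (suc m) x = begin
  step (Kpair (suc m) (x ∘ inject₁))
    ≡⟨ cong step (Kpair≡col₁-backwardProd m (x ∘ inject₁)) ⟩
  step (col₁ (backwardProd (suc m) (x ∘ inject₁)))
    ≡⟨ sym (col₁-digit (x (fromℕ (suc m))) (backwardProd (suc m) (x ∘ inject₁))) ⟩
  col₁ (backwardProd (suc (suc m)) x)
    ∎
  where
  step : ℕ × ℕ → ℕ × ℕ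
  step (p , q) = x (fromℕ (suc m)) * p + q , p

cf≡col₁-forwardProd : ∀ n (x : Vector ℕ (suc n)) → cf n x ≡ col₁ (forwardProd (suc n) x)
cf≡col₁-forwardProd zero    x = cong col₁ (sym (⊗-identityʳ (digit (head x))))
cf≡col₁-forwardProd (suc n) x = begin
  step (cf n (tail x))
    ≡⟨ cong step (cf≡col₁-forwardProd n (tail x)) ⟩
  step (col₁ (forwardProd (suc n) (tail x)))
    ≡⟨ sym (col₁-digit (head x) (forwardProd (suc n) (tail x))) ⟩
  col₁ (forwardProd (suc (suc n)) x)
    ∎
  where
  step : ℕ × ℕ → ℕ × ℕ
  step (p , q) = head x * p + q , p

continuant≡numerator : ∀ n (x : Vector ℕ (suc n)) → K (suc n) x ≡ proj₁ (cf n x)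
continuant≡numerator n x = begin
  K (suc n) x                          ≡⟨ cong proj₁ (Kpair≡col₁-backwardProd n x) ⟩
  e₁₁ (backwardProd (suc n) x)         ≡⟨ cong e₁₁ (backwardProd≡forwardProdᵀ (suc n) x) ⟩
  e₁₁ (forwardProd (suc n) x)          ≡⟨ cong proj₁ (cf≡col₁-forwardProd n x) ⟨
  proj₁ (cf n x)                       ∎

-- Fact (2a): the continued fraction is computed in lowest terms, since a
-- common divisor of (x p + q) and p also divides q.
cf-coprime : ∀ n (x : Vector ℕ (suc n)) → Coprime (proj₁ (cf n x)) (proj₂ (cf n x))
cf-coprime zero    x (_ , d∣1)         = ∣1⇒≡1 d∣1
cf-coprime (suc n) x (d∣xp+q , d∣p) =
  cf-coprime n (tail x) (d∣p , ∣m+n∣m⇒∣n d∣xp+q (∣n⇒∣m*n (head x) d∣p))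

cf-numerator-positive : ∀ n (x : Vector ℕ (suc n)) → Positive n x → 1 ≤ proj₁ (cf n x)
cf-numerator-positive zero    x x>0 = x>0 Data.Fin.zero
cf-numerator-positive (suc n) x x>0 = ≤-trans p≥1 (≤-trans p≤xp (m≤m+n _ _))
  where
  p = proj₁ (cf n (tail x))
  p≥1 : 1 ≤ p
  p≥1 = cf-numerator-positive n (tail x) (x>0 ∘ Data.Fin.suc)
  p≤xp : p ≤ head x * p
  p≤xp = ≤-trans (≤-reflexive (sym (*-identityˡ p))) (*-monoˡ-≤ p (x>0 Data.Fin.zero))

cross-multiplied⇒∣ : ∀ {P Q P′ Q′} k → Coprime P′ Q′ → P * Q′ ≡ k * P′ * Q → P′ ∣ P
cross-multiplied⇒∣ {P} {Q} {P′} {Q′} k P′⊥Q′ eq = coprime-divisor P′⊥Q′ (divides (k * Q) (begin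
  Q′ * P       ≡⟨ *-comm Q′ P ⟩
  P * Q′       ≡⟨ eq ⟩
  k * P′ * Q   ≡⟨ regroup k P′ Q ⟩
  k * Q * P′   ∎))
  where
  regroup : ∀ k P′ Q → k * P′ * Q ≡ k * Q * P′
  regroup = solve-∀

∣-below-double⇒≡ : ∀ {P P′} → P′ ∣ P → 1 ≤ P → P < 2 * P′ → P ≡ P′
∣-below-double⇒≡ (divides zero          refl) P≥1 _ = ⊥-elim (<-irrefl refl (≤-trans P≥1 z≤n))
∣-below-double⇒≡ (divides (suc zero)    refl) _   _ = +-identityʳ _
∣-below-double⇒≡ {P′ = P′} (divides (suc (suc c)) refl) _ P<2P′ =
  ⊥-elim (<-irrefl refl (<-≤-trans P<2P′ (*-monoˡ-≤ P′ {2} {suc (suc c)} (s≤s (s≤s z≤n)))))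

theorem6 : (n k : ℕ) → 1 < k → (σ : Permutation′ (suc n)) → (a : Fin (suc n) → ℕ)
    → Positive n a → Canonical n a → Canonical n (λ i → a (σ ⟨$⟩ʳ i))
    → EqTimes (cf n a) k (cf n (λ i → a (σ ⟨$⟩ʳ i)))
    → K (suc n) a < 2 * K (suc n) (λ i → a (σ ⟨$⟩ʳ i))
    → K (suc n) a ≡ K (suc n) (λ i → a (σ ⟨$⟩ʳ i))
theorem6 n k _ σ a a>0 _ _ permutiple p<2p′ = begin
  K (suc n) a       ≡⟨ continuant≡numerator n a ⟩
  proj₁ (cf n a)    ≡⟨ ∣-below-double⇒≡ P′∣P (cf-numerator-positive n a a>0) P<2P′ ⟩
  proj₁ (cf n a′)   ≡⟨ continuant≡numerator n a′ ⟨
  K (suc n) a′      ∎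
  where
  a′ : Vector ℕ (suc n)
  a′ i = a (σ ⟨$⟩ʳ i)
  P′∣P : proj₁ (cf n a′) ∣ proj₁ (cf n a)
  P′∣P = cross-multiplied⇒∣ k (cf-coprime n a′) permutiple
  P<2P′ : proj₁ (cf n a) < 2 * proj₁ (cf n a′)
  P<2P′ = subst₂ (λ u v → u < 2 * v) (continuant≡numerator n a) (continuant≡numerator n a′) p<2p′
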